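{- Let $d\in\mathbb{N}$. Every finite union $\bigcup_{i=1}^k\mathcal{P}_{\rho_i}$, where each $\rho_i$ is a $0$-profile (for some radius $r_i$ and degree $d$), is a GSF-local property of undirected graphs.
   Context: $\mathcal{C}_d$ is the class of finite simple undirected graphs of maximum degree at most $d$. For a graph $G$ and vertex $v$, $\mathcal{N}_r^G(v)$ is the subgraph induced by the vertices at distance at most $r$ from $v$. An $r$-ball is a pair $(B,b)$ with $b\in V(B)$ and every vertex of $B$ at distance at most $r$ from $b$; an $r$-type is an isomorphism class of $r$-balls (isomorphisms mapping centre to centre). There are finitely many $r$-types of graphs of degree at most $d$; fix an enumeration $\tau^1,\dots,\tau^{n_{d,r}}$. The $r$-histogram vector of $G\in\mathcal{C}_d$ has $i$-th entry the number of vertices $v$ with $(\mathcal{N}_r^G(v),v)\in\tau^i$. An $r$-neighbourhood profile of degree $d$ is a map $\rho$ from $\{1,\dots,n_{d,r}\}$ to the set of intervals $[k,l]$ ($k\le l\in\mathbb{N}$) and $[k,\infty)$ ($k\in\mathbb{N}$); $G$ obeys $\rho$ if its $i$-th histogram entry lies in $\rho(i)$ for all $i$, and $\mathcal{P}_\rho:=\{G\in\mathcal{C}_d\mid G\text{ obeys }\rho\}$. A $0$-profile is a profile all of whose values are of the form $[0,k]$ or $[0,\infty)$. For a vertex $v$, $N_1^G(v)$ is $v$ together with its neighbours. A marked graph is a graph each of whose vertices is marked 'full', 'semifull' or 'partial'. An embedding of a marked graph $F$ into $G$ is an injective $f:V(F)\to V(G)$ such that for every $v\in V(F)$: if $v$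 is full, $N_1^G(f(v))=f(N_1^F(v))$; if semifull, $N_1^G(f(v))\cap f(V(F))=f(N_1^F(v))$; if partial, $N_1^G(f(v))\supseteq f(N_1^F(v))$. $G$ is $\mathcal{F}$-free if no $F\in\mathcal{F}$ embeds into $G$. A property $\mathcal{P}=\bigcup_n\mathcal{P}_n$ ($\mathcal{P}_n$ the $n$-vertex members) is GSF-local if there are a sequence $(\mathcal{F}_n)_{n\in\mathbb{N}}$ of sets of marked graphs and an integer $s$ such that for every $n$ each graph in $\mathcal{F}_n$ has at most $s$ vertices and $\mathcal{P}_n$ is exactly the set of $n$-vertex graphs that are $\mathcal{F}_n$-free. -}

module Defs where

open import Data.Nat using (ℕ; zero; suc; _+_; _≤_)
open import Data.Fin using (Fin)
import Data.Fin as Fin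
open import Data.Bool using (Bool; true; false; if_then_else_)
open import Data.Maybe using (Maybe; just; nothing)
open import Data.Product using (Σ; Σ-syntax; ∃; ∃-syntax; _×_; _,_)
open import Data.Sum using (_⊎_)
open import Data.List using (List; length)
open import Data.List.Membership.Propositional using (_∈_)
open import Data.List.Relation.Unary.Unique.Propositional using (Unique)
open import Relation.Binary.PropositionalEquality using (_≡_)
open import Relation.Nullary using (¬_)
open import Function.Bundles using (_⇔_)
open import Function.Definitions using (Injective)
open import Level using (0ℓ)

record Graph (n : ℕ) : Set where
  field
    adj    : Fin n → Fin n → Bool
    sym    : ∀ u v → adj u v ≡ adj v u
    irrefl : ∀ v → adj v v ≡ false
open Graph public

count : ∀ {n} → (Fin n → Bool) → ℕ
count {zero}  p = 0
count {suc n} p = (if p Fin.zero then 1 else 0) + count (λ i → p (Fin.suc i))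

degree : ∀ {n} → Graph n → Fin n → ℕ
degree G v = count (adj G v)

MaxDeg≤ : ∀ {n} → Graph n → ℕ → Set
MaxDeg≤ G d = ∀ v → degree G v ≤ d

Within : ∀ {n} → Graph n → ℕ → Fin n → Fin n → Set
Within G zero    u v = u ≡ v
Within G (suc r) u v = u ≡ v ⊎ (Σ[ w ∈ _ ] (adj G u w ≡ true × Within G r w v))

IsBall : ∀ {m} → Graph m → ℕ → Fin m → Set
IsBall B r b = ∀ x → Within B r b x

-- r-balls of degree at most d (representatives of r-types of degree ≤ d)
record RBall (d r : ℕ) : Set where
  constructor ball
  field
    size   : ℕ
    graph  : Graph size
    centre : Fin size
    degOK  : MaxDeg≤ graph d
    isBall : IsBall graph r centre
open RBall public

record RootedIso {d r} (β γ : RBall d r) : Set where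
  field
    to      : Fin (size β) → Fin (size γ)
    from    : Fin (size γ) → Fin (size β)
    from∘to : ∀ x → from (to x) ≡ x
    to∘from : ∀ y → to (from y) ≡ y
    centre≡ : to (centre β) ≡ centre γ
    adj≡    : ∀ x y → adj (graph β) x y ≡ adj (graph γ) (to x) (to y)

NbhdIso : ∀ {d n} (r : ℕ) → Graph n → Fin n → RBall d r → Set
NbhdIso {n = n} r G v β =
  Σ[ f ∈ (Fin (size β) → Fin n) ]
    ( Injective _≡_ _≡_ f
    × (∀ y → Within G r v (f y))
    × (∀ x → Within G r v x → Σ[ y ∈ Fin (size β) ] f y ≡ x)
    × f (centre β) ≡ v
    × (∀ y z → adj (graph β) y z ≡ adj G (f y) (f z)) )

HistCount : ∀ {d n} (r : ℕ) → Graph n → RBall d r → ℕ → Set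
HistCount {n = n} r G β c =
  Σ[ xs ∈ List (Fin n) ]
    ( Unique xs
    × (∀ v → (v ∈ xs) ⇔ NbhdIso r G v β)
    × length xs ≡ c )

-- [lower , upper] with upper = nothing meaning [lower , ∞)
record Interval : Set where
  constructor [_,_]
  field
    lower : ℕ
    upper : Maybe ℕ
open Interval public

_∈I_ : ℕ → Interval → Set
c ∈I [ k , just l ]  = k ≤ c × c ≤ l
c ∈I [ k , nothing ] = k ≤ c

record Profile (d r : ℕ) : Set where
  field
    ρ         : RBall d r → Interval
    invariant : ∀ β γ → RootedIso β γ → ρ β ≡ ρ γ
open Profile public

IsZeroProfile : ∀ {d r} → Profile d r → Set
IsZeroProfile P = ∀ β → lower (ρ P β) ≡ 0

Obeys : ∀ {d r n} → Graph n → Profile d r → Set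
Obeys {d} {r} G P =
  MaxDeg≤ G d × (∀ β c → HistCount r G β c → c ∈I ρ P β)

data Mark : Set where
  full semifull partial : Mark

record MarkedGraph (m : ℕ) : Set where
  field
    base : Graph m
    mark : Fin m → Mark
open MarkedGraph public

InN1 : ∀ {n} → Graph n → Fin n → Fin n → Set
InN1 G v x = x ≡ v ⊎ adj G v x ≡ true

InImage : ∀ {m n} → (Fin m → Fin n) → Fin n → Set
InImage f x = Σ[ y ∈ _ ] x ≡ f y

InImageN1 : ∀ {m n} → Graph m → (Fin m → Fin n) → Fin m → Fin n → Set
InImageN1 F f v x = Σ[ y ∈ _ ] (x ≡ f y × InN1 F v y)

EmbedCond : ∀ {m n} → Mark → Graph m → Graph n → (Fin m → Fin n) → Fin m → Set
EmbedCond full     F G f v = ∀ x → InN1 G (f v) x ⇔ InImageN1 F f v x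
EmbedCond semifull F G f v = ∀ x → (InN1 G (f v) x × InImage f x) ⇔ InImageN1 F f v x
EmbedCond partial  F G f v = ∀ x → InImageN1 F f v x → InN1 G (f v) x

Embeds : ∀ {m n} → MarkedGraph m → Graph n → Set
Embeds {m} {n} H G =
  Σ[ f ∈ (Fin m → Fin n) ]
    ( Injective _≡_ _≡_ f
    × (∀ v → EmbedCond (mark H v) (base H) G f v) )

MarkedSet : Set₁
MarkedSet = Σ ℕ MarkedGraph → Set

Free : ∀ {n} → MarkedSet → Graph n → Set
Free 𝓕 G = ∀ m (H : MarkedGraph m) → 𝓕 (m , H) → ¬ Embeds H G

GraphProperty : Set₁
GraphProperty = ∀ {n} → Graph n → Set

IsGSFLocal : GraphProperty → Set₁
IsGSFLocal P =
  Σ[ 𝓕 ∈ (ℕ → MarkedSet) ] Σ[ s ∈ ℕ ]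
    ( (∀ n m (H : MarkedGraph m) → 𝓕 n (m , H) → m ≤ s)
    × (∀ n (G : Graph n) → P G ⇔ Free (𝓕 n) G) )

UnionOfProfiles : ∀ d k (rs : Fin k → ℕ) → ((i : Fin k) → Profile d (rs i)) → GraphProperty
UnionOfProfiles d k rs ρs G = Σ[ i ∈ Fin k ] Obeys G (ρs i)

{-# OPTIONS --safe #-}
-- A graph of maximum degree ≤ d violates a 0-profile ρ only by having too many vertices of some r-type β,
-- say more than u, the upper end of ρ(β). This is witnessed locally: take u + 1 such centres together with
-- their r-balls, mark every vertex at distance < r from a centre full and the others semifull. Wherever
-- this marked graph embeds, full vertices keep their whole neighbourhood, so the images of the centres
-- again have r-type β and the histogram entry again exceeds u. A vertex of degree > d is witnessed the same
-- way by d + 1 of its neighbours. As there are finitely many r-types, these witnesses have bounded size.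
-- A graph outside the union violates every ρᵢ, and the union of its k witnesses is a forbidden marked graph
-- of bounded size; conversely no graph of the union contains one.
module Submission where

open import Defs hiding (sym)
open import Data.Nat using (ℕ; zero; suc; _+_; _*_; _^_; _≤_; _<_; _≤?_; z≤n; s≤s)
open import Data.Nat.Properties using (≤-trans; ≤-antisym; ≰⇒>; 1+n≰n; n≤1+n; m≤m+n; m≤n+m; +-mono-≤; *-mono-≤; +-suc; *-suc; +-identityʳ; m≤n⇒m⊓n≡m; ≤-reflexive; module ≤-Reasoning)
open import Data.Fin using (Fin; toℕ; fromℕ<; combine; remQuot; funToFin; finToFun) renaming (zero to fz; suc to fs)
open import Data.Fin.Properties using (injective⇒≤; any?; all?; ¬∀⟶∃¬; remQuot-combine; toℕ-fromℕ<; toℕ<n; finToFun-funToFin) renaming (_≟_ to _≟F_)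
open import Data.Bool using (Bool; true; false; if_then_else_)
open import Data.Bool.Properties using (⇔→≡; not-¬) renaming (_≟_ to _≟B_)
open import Data.Maybe using (just; nothing)
open import Data.Product using (Σ; Σ-syntax; _×_; _,_; proj₁; proj₂; uncurry)
open import Data.Sum using (_⊎_; inj₁; inj₂)
open import Data.Empty using (⊥; ⊥-elim)
open import Data.List using (List; []; _∷_; length; map; filter; lookup; allFin; take; tabulate; concatMap; _++_; upTo)
open import Data.Nat.ListAction using (sum)
open import Data.List.Extrema.Nat using (max; xs≤max)
open import Data.List.Properties using (length-take; length-map; length-++; length-tabulate)
open import Data.List.Membership.Propositional using (_∈_; find; lose)
open import Data.List.Membership.Propositional.Properties using (∈-lookup; ∈-allFin; ∈-filter⁺; ∈-filter⁻; ∈-map⁺; ∈-map⁻; ∈-++⁺ˡ; ∈-++⁺ʳ; ∈-concatMap⁺; ∈-upTo⁺)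
open import Data.List.Relation.Binary.Subset.Propositional using (_⊆_)
open import Data.List.Relation.Unary.Any using (here; there; index) renaming (any? to anyL?)
open import Data.List.Relation.Unary.Any.Properties using (lookup-index)
open import Data.List.Relation.Unary.All as All using (All; []; _∷_)
open import Data.List.Relation.Unary.All.Properties using (¬All⇒Any¬)
open import Data.List.Relation.Unary.AllPairs using ([]; _∷_)
open import Data.List.Relation.Unary.Unique.Propositional using (Unique)
open import Data.List.Relation.Unary.Unique.Propositional.Properties using (allFin⁺; filter⁺; take⁺)
open import Data.Vec.Functional using () renaming (_∷_ to _∷ᶠ_)
open import Relation.Binary.PropositionalEquality using (_≡_; _≢_; refl; sym; trans; cong; cong₂; subst; subst₂; module ≡-Reasoning)
open import Relation.Nullary using (¬_; Dec; yes; no; does)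
open import Relation.Nullary.Decidable using (_×-dec_; _⊎-dec_; _→-dec_; map′; dec-true)
open import Function.Base using (_∘_)
open import Function.Bundles using (mk⇔; Equivalence)
open import Function.Definitions using (Injective)

unique⇒lookup-injective : ∀ {A : Set} {xs : List A} → Unique xs → Injective _≡_ _≡_ (lookup xs)
unique⇒lookup-injective {xs = x ∷ xs} (x∉ ∷ u) {fz} {fz} eq = refl
unique⇒lookup-injective {xs = x ∷ xs} (x∉ ∷ u) {fz} {fs j} eq = ⊥-elim (All.lookup x∉ (∈-lookup {xs = xs} j) eq)
unique⇒lookup-injective {xs = x ∷ xs} (x∉ ∷ u) {fs i} {fz} eq = ⊥-elim (All.lookup x∉ (∈-lookup {xs = xs} i) (sym eq))
unique⇒lookup-injective {xs = x ∷ xs} (x∉ ∷ u) {fs i} {fs j} eq = cong fs (unique⇒lookup-injective u eq)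

-- Pigeonhole: the positions of a duplicate-free list inject into those of any superset.
unique-⊆⇒length≤ : ∀ {A : Set} {xs ys : List A} → Unique xs → xs ⊆ ys → length xs ≤ length ys
unique-⊆⇒length≤ {xs = xs} {ys} u xs⊆ys = injective⇒≤ {f = position} position-injective
  where
  open ≡-Reasoning
  position : Fin (length xs) → Fin (length ys)
  position i = index (xs⊆ys (∈-lookup {xs = xs} i))
  position-injective : Injective _≡_ _≡_ position
  position-injective {i} {j} eq = unique⇒lookup-injective u (begin
    lookup xs i                             ≡⟨ lookup-index (xs⊆ys (∈-lookup {xs = xs} i)) ⟩
    lookup ys (position i)                  ≡⟨ cong (lookup ys) eq ⟩
    lookup ys (position j)                  ≡⟨ lookup-index (xs⊆ys (∈-lookup {xs = xs} j)) ⟨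
    lookup xs j                             ∎)

unique-map⁺-injectiveOn : ∀ {A B : Set} (f : A → B) (P : A → Set) {xs : List A} → All P xs →
  (∀ {x y} → P x → P y → f x ≡ f y → x ≡ y) → Unique xs → Unique (map f xs)
unique-map⁺-injectiveOn f P [] f-inj [] = []
unique-map⁺-injectiveOn f P (px ∷ pxs) f-inj (x∉ ∷ u) = images-distinct pxs x∉ ∷ unique-map⁺-injectiveOn f P pxs f-inj u
  where
  images-distinct : ∀ {ys} → All P ys → All (_ ≢_) ys → All (f _ ≢_) (map f ys)
  images-distinct [] [] = []
  images-distinct (py ∷ pys) (x≢y ∷ x≢ys) = (λ eq → x≢y (f-inj px py eq)) ∷ images-distinct pys x≢ys

take-⊆ : ∀ {A : Set} k (xs : List A) → take k xs ⊆ xs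
take-⊆ (suc k) (y ∷ xs) (here eq) = here eq
take-⊆ (suc k) (y ∷ xs) (there p) = there (take-⊆ k xs p)

∈-of-nonempty : ∀ {A : Set} (xs : List A) → 0 < length xs → Σ[ x ∈ A ] x ∈ xs
∈-of-nonempty (x ∷ xs) _ = x , here refl

does⇒witness : ∀ {P : Set} (p? : Dec P) → does p? ≡ true → P
does⇒witness (yes p) _ = p
does⇒witness (no _) ()

length-take≡ : ∀ {A : Set} {k} (xs : List A) → k ≤ length xs → length (take k xs) ≡ k
length-take≡ {k = k} xs k≤ = trans (length-take k xs) (m≤n⇒m⊓n≡m k≤)

length-concatMap≤sum : ∀ {A B : Set} (f : A → List B) (bound : A → ℕ) (xs : List A) →
  (∀ x → length (f x) ≤ bound x) → length (concatMap f xs) ≤ sum (map bound xs)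
length-concatMap≤sum f bound [] f≤ = z≤n
length-concatMap≤sum f bound (x ∷ xs) f≤ =
  subst (_≤ _) (sym (length-++ (f x))) (+-mono-≤ (f≤ x) (length-concatMap≤sum f bound xs f≤))

length-concatMap-const : ∀ {A B : Set} {s} (f : A → Fin s → B) (xs : List A) →
  length (concatMap (λ x → map (f x) (allFin s)) xs) ≡ length xs * s
length-concatMap-const f [] = refl
length-concatMap-const {s = s} f (x ∷ xs) = begin
  length (map (f x) (allFin s) ++ _)  ≡⟨ length-++ (map (f x) (allFin s)) ⟩
  length (map (f x) (allFin s)) + _   ≡⟨ cong₂ _+_ (trans (length-map (f x) (allFin s)) (length-tabulate (λ i → i)))
                                                   (length-concatMap-const f xs) ⟩
  s + length xs * s                   ∎
  where open ≡-Reasoning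

∀⊎⇒∃⊎∀ : ∀ k {A B : Fin k → Set} → (∀ i → A i ⊎ B i) → (Σ[ i ∈ Fin k ] A i) ⊎ (∀ i → B i)
∀⊎⇒∃⊎∀ zero choice = inj₂ (λ ())
∀⊎⇒∃⊎∀ (suc k) choice with choice fz | ∀⊎⇒∃⊎∀ k (choice ∘ fs)
... | inj₁ a | _             = inj₁ (fz , a)
... | inj₂ b | inj₁ (i , a)  = inj₁ (fs i , a)
... | inj₂ b | inj₂ bs       = inj₂ λ { fz → b ; (fs i) → bs i }

length-filter-tabulate : ∀ {A : Set} n (h : Fin n → A) (q : A → Bool) →
  length (filter (λ a → q a ≟B true) (tabulate h)) ≡ count (q ∘ h)
length-filter-tabulate zero h q = refl
length-filter-tabulate (suc n) h q with q (h fz)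
... | true  = cong suc (length-filter-tabulate n (h ∘ fs) q)
... | false = length-filter-tabulate n (h ∘ fs) q

count-cong : ∀ {n} {p q : Fin n → Bool} → (∀ i → p i ≡ q i) → count p ≡ count q
count-cong {zero} p≗q = refl
count-cong {suc n} p≗q = cong₂ _+_ (cong (λ b → if b then 1 else 0) (p≗q fz)) (count-cong (p≗q ∘ fs))

neighbours : ∀ {n} → Graph n → Fin n → List (Fin n)
neighbours {n} G v = filter (λ w → adj G v w ≟B true) (allFin n)

length-neighbours : ∀ {n} (G : Graph n) v → length (neighbours G v) ≡ degree G v
length-neighbours {n} G v = length-filter-tabulate n (λ i → i) (adj G v)

∈-neighbours⁺ : ∀ {n} (G : Graph n) {v w} → adj G v w ≡ true → w ∈ neighbours G v
∈-neighbours⁺ G {v} {w} vw = ∈-filter⁺ (λ w → adj G v w ≟B true) (∈-allFin w) vw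

∈-neighbours⁻ : ∀ {n} (G : Graph n) {v w} → w ∈ neighbours G v → adj G v w ≡ true
∈-neighbours⁻ {n} G {v} p = proj₂ (∈-filter⁻ (λ w → adj G v w ≟B true) {xs = allFin n} p)

neighbours-unique : ∀ {n} (G : Graph n) v → Unique (neighbours G v)
neighbours-unique {n} G v = filter⁺ (λ w → adj G v w ≟B true) (allFin⁺ n)

Within-refl : ∀ {n} (G : Graph n) t v → Within G t v v
Within-refl G zero    v = refl
Within-refl G (suc t) v = inj₁ refl

Within-snoc : ∀ {n} (G : Graph n) t {u w y} → Within G t u w → adj G w y ≡ true → Within G (suc t) u y
Within-snoc G zero    {y = y} refl wy = inj₂ (y , wy , refl)
Within-snoc G (suc t) {y = y} (inj₁ refl) wy = inj₂ (y , wy , Within-refl G (suc t) y)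
Within-snoc G (suc t) (inj₂ (w , uw , w⇝)) wy = inj₂ (w , uw , Within-snoc G t w⇝ wy)

Within-mono : ∀ {n} (G : Graph n) {s t u v} → s ≤ t → Within G s u v → Within G t u v
Within-mono G {zero} {zero}  z≤n p = p
Within-mono G {zero} {suc t} z≤n p = inj₁ p
Within-mono G {suc s} {suc t} (s≤s s≤t) (inj₁ p) = inj₁ p
Within-mono G {suc s} {suc t} (s≤s s≤t) (inj₂ (w , uw , w⇝)) = inj₂ (w , uw , Within-mono G s≤t w⇝)

Within-cong : ∀ {n} {G H : Graph n} → (∀ x y → adj G x y ≡ adj H x y) → ∀ t {u v} → Within G t u v → Within H t u v
Within-cong G≗H zero    p = p
Within-cong G≗H (suc t) (inj₁ p) = inj₁ p
Within-cong G≗H (suc t) {u} (inj₂ (w , uw , w⇝)) = inj₂ (w , trans (sym (G≗H u w)) uw , Within-cong G≗H t w⇝)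

Within? : ∀ {n} (G : Graph n) t u v → Dec (Within G t u v)
Within? G zero    u v = u ≟F v
Within? G (suc t) u v = (u ≟F v) ⊎-dec any? (λ w → (adj G u w ≟B true) ×-dec Within? G t w v)

Within< : ∀ {n} → Graph n → ℕ → Fin n → Fin n → Set
Within< G zero    v x = ⊥
Within< G (suc r) v x = Within G r v x

Within<? : ∀ {n} (G : Graph n) r v x → Dec (Within< G r v x)
Within<? G zero    v x = no λ ()
Within<? G (suc r) v x = Within? G r v x

Within<⇒Within : ∀ {n} (G : Graph n) r {v x} → Within< G r v x → Within G r v x
Within<⇒Within G (suc r) v⇝x = Within-mono G (n≤1+n r) v⇝x

Within<-step : ∀ {n} (G : Graph n) r {v x y} → Within< G r v x → adj G x y ≡ true → Within G r v y
Within<-step G (suc r) v⇝x x~y = Within-snoc G r v⇝x x~y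

∃-function? : ∀ a {b} (P : (Fin a → Fin b) → Set) → (∀ f → Dec (P f)) →
  (∀ {f g} → (∀ x → f x ≡ g x) → P f → P g) → Dec (Σ (Fin a → Fin b) P)
∃-function? zero P P? P-resp with P? (λ ())
... | yes p = yes (_ , p)
... | no ¬p = no λ (f , pf) → ¬p (P-resp (λ ()) pf)
∃-function? (suc a) P P? P-resp
  with any? (λ y → ∃-function? a (P ∘ (y ∷ᶠ_)) (P? ∘ (y ∷ᶠ_)) (λ f≗g → P-resp λ { fz → refl ; (fs x) → f≗g x }))
... | yes (y , g , p) = yes (y ∷ᶠ g , p)
... | no ¬p = no λ (f , pf) → ¬p (f fz , f ∘ fs , P-resp (λ { fz → refl ; (fs x) → refl }) pf)

-- NbhdIso r G v β is Σ f (IsNbhdIso r G v β f).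
IsNbhdIso : ∀ {d n} (r : ℕ) → Graph n → Fin n → (β : RBall d r) → (Fin (size β) → Fin n) → Set
IsNbhdIso r G v β f =
    ( Injective _≡_ _≡_ f
    × (∀ y → Within G r v (f y))
    × (∀ x → Within G r v x → Σ[ y ∈ Fin (size β) ] f y ≡ x)
    × f (centre β) ≡ v
    × (∀ y z → adj (graph β) y z ≡ adj G (f y) (f z)) )

injective? : ∀ {a b} (f : Fin a → Fin b) → Dec (Injective _≡_ _≡_ f)
injective? f = map′ (λ h {x} {y} → h x y) (λ h x y → h {x} {y})
  (all? λ x → all? λ y → (f x ≟F f y) →-dec (x ≟F y))

IsNbhdIso? : ∀ {d n} r (G : Graph n) v (β : RBall d r) f → Dec (IsNbhdIso r G v β f)
IsNbhdIso? r G v β f =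
  injective? f
  ×-dec all? (λ y → Within? G r v (f y))
  ×-dec all? (λ x → Within? G r v x →-dec any? λ y → f y ≟F x)
  ×-dec (f (centre β) ≟F v)
  ×-dec all? (λ y → all? λ z → adj (graph β) y z ≟B adj G (f y) (f z))

IsNbhdIso-resp-≗ : ∀ {d n} r (G : Graph n) v (β : RBall d r) {f g} → (∀ x → f x ≡ g x) →
  IsNbhdIso r G v β f → IsNbhdIso r G v β g
IsNbhdIso-resp-≗ r G v β {f} {g} f≗g (f-inj , f-in , f-onto , f-centre , f-adj) =
    (λ {x} {y} gx≡gy → f-inj (trans (f≗g x) (trans gx≡gy (sym (f≗g y)))))
  , (λ y → subst (Within G r v) (f≗g y) (f-in y))
  , (λ x x∈ → let (y , fy≡x) = f-onto x x∈ in y , trans (sym (f≗g y)) fy≡x)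
  , trans (sym (f≗g (centre β))) f-centre
  , (λ y z → trans (f-adj y z) (cong₂ (adj G) (f≗g y) (f≗g z)))

NbhdIso? : ∀ {d n} r (G : Graph n) v (β : RBall d r) → Dec (NbhdIso r G v β)
NbhdIso? r G v β = ∃-function? (size β) (IsNbhdIso r G v β) (IsNbhdIso? r G v β) (IsNbhdIso-resp-≗ r G v β)

NbhdIso-resp-≅ : ∀ {d n r} {G : Graph n} {v} {β γ : RBall d r} → RootedIso β γ → NbhdIso r G v β → NbhdIso r G v γ
NbhdIso-resp-≅ {G = G} {β = β} {γ} i (f , f-inj , f-in , f-onto , f-centre , f-adj) =
    f ∘ from
  , (λ {x} {y} eq → trans (sym (to∘from x)) (trans (cong to (f-inj eq)) (to∘from y)))
  , f-in ∘ from
  , (λ x x∈ → let (y , fy≡x) = f-onto x x∈ in to y , trans (cong f (from∘to y)) fy≡x)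
  , trans (cong f (trans (cong from (sym centre≡)) (from∘to (centre β)))) f-centre
  , (λ y z → trans (sym (trans (adj≡ (from y) (from z)) (cong₂ (adj (graph γ)) (to∘from y) (to∘from z))))
                   (f-adj (from y) (from z)))
  where open RootedIso i

RootedIso-sym : ∀ {d r} {β γ : RBall d r} → RootedIso β γ → RootedIso γ β
RootedIso-sym {β = β} {γ} i = record
  { to = from ; from = to ; from∘to = to∘from ; to∘from = from∘to
  ; centre≡ = trans (cong from (sym centre≡)) (from∘to (centre β))
  ; adj≡ = λ x y → sym (trans (adj≡ (from x) (from y)) (cong₂ (adj (graph γ)) (to∘from x) (to∘from y))) }
  where open RootedIso i

centres : ∀ {d n} r (G : Graph n) (β : RBall d r) → List (Fin n)
centres {n = n} r G β = filter (λ v → NbhdIso? r G v β) (allFin n)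

∈-centres⁻ : ∀ {d n} r (G : Graph n) (β : RBall d r) {v} → v ∈ centres r G β → NbhdIso r G v β
∈-centres⁻ {n = n} r G β p = proj₂ (∈-filter⁻ (λ v → NbhdIso? r G v β) {xs = allFin n} p)

∈-centres⁺ : ∀ {d n} r (G : Graph n) (β : RBall d r) {v} → NbhdIso r G v β → v ∈ centres r G β
∈-centres⁺ r G β {v} = ∈-filter⁺ (λ v → NbhdIso? r G v β) (∈-allFin v)

centres-unique : ∀ {d n} r (G : Graph n) (β : RBall d r) → Unique (centres r G β)
centres-unique {n = n} r G β = filter⁺ (λ v → NbhdIso? r G v β) (allFin⁺ n)

histCount-centres : ∀ {d n} r (G : Graph n) (β : RBall d r) → HistCount r G β (length (centres r G β))
histCount-centres {n = n} r G β =
  centres r G β , centres-unique r G β , (λ v → mk⇔ (∈-centres⁻ r G β) (∈-centres⁺ r G β)) , refl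

HistCount-functional : ∀ {d n} r (G : Graph n) (β : RBall d r) {c c′} → HistCount r G β c → HistCount r G β c′ → c ≡ c′
HistCount-functional r G β (xs , xs-u , xs⇔ , refl) (ys , ys-u , ys⇔ , refl) =
  ≤-antisym (unique-⊆⇒length≤ xs-u λ {v} p → Equivalence.from (ys⇔ v) (Equivalence.to (xs⇔ v) p))
            (unique-⊆⇒length≤ ys-u λ {v} p → Equivalence.from (xs⇔ v) (Equivalence.to (ys⇔ v) p))

HistCount-resp-≅ : ∀ {d n r} {G : Graph n} {β γ : RBall d r} {c} → RootedIso β γ → HistCount r G β c → HistCount r G γ c
HistCount-resp-≅ i (xs , xs-u , xs⇔ , len) =
  xs , xs-u , (λ v → mk⇔ (NbhdIso-resp-≅ i ∘ Equivalence.to (xs⇔ v))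
                         (Equivalence.from (xs⇔ v) ∘ NbhdIso-resp-≅ (RootedIso-sym i))) , len

lookupOr : ∀ {A : Set} → List A → ℕ → A → A
lookupOr []       j       a = a
lookupOr (x ∷ xs) zero    a = x
lookupOr (x ∷ xs) (suc j) a = lookupOr xs j a

lookupOr-index : ∀ {A : Set} {xs : List A} {x} a (p : x ∈ xs) → lookupOr xs (toℕ (index p)) a ≡ x
lookupOr-index a (here refl) = refl
lookupOr-index a (there p)   = lookupOr-index a p

module _ (d : ℕ) where

  step : ∀ {s} → Graph s → Fin s → Fin (suc d) → Fin s
  step G v fz     = v
  step G v (fs j) = lookupOr (neighbours G v) (toℕ j) v

  walk : ∀ {s} → Graph s → Fin s → ∀ t → (Fin t → Fin (suc d)) → Fin s
  walk G v zero    w = v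
  walk G v (suc t) w = walk G (step G v (w fz)) t (w ∘ fs)

  walk-cong : ∀ {s} (G : Graph s) v t {w w′} → (∀ i → w i ≡ w′ i) → walk G v t w ≡ walk G v t w′
  walk-cong G v zero    w≗w′ = refl
  walk-cong G v (suc t) w≗w′ rewrite w≗w′ fz = walk-cong G _ t (w≗w′ ∘ fs)

  walk-complete : ∀ {s} (G : Graph s) → MaxDeg≤ G d → ∀ t v x → Within G t v x →
    Σ[ w ∈ (Fin t → Fin (suc d)) ] walk G v t w ≡ x
  walk-complete G dg zero v x v≡x = (λ ()) , v≡x
  walk-complete G dg (suc t) v x (inj₁ refl) =
    let (w , walk≡) = walk-complete G dg t v v (Within-refl G t v) in fz ∷ᶠ w , walk≡
  walk-complete G dg (suc t) v x (inj₂ (u , vu , u⇝x)) =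
    let (w , walk≡) = walk-complete G dg t u x u⇝x in fs (fromℕ< j<d) ∷ᶠ w , trans (cong (λ y → walk G y t w) step≡u) walk≡
    where
    u∈ = ∈-neighbours⁺ G vu
    j<d : toℕ (index u∈) < d
    j<d = ≤-trans (toℕ<n (index u∈)) (subst (_≤ d) (sym (length-neighbours G v)) (dg v))
    step≡u : step G v (fs (fromℕ< j<d)) ≡ u
    step≡u = trans (cong (λ j → lookupOr (neighbours G v) j v) (toℕ-fromℕ< j<d)) (lookupOr-index v u∈)

-- Every vertex of an r-ball of degree ≤ d is reached by a walk of r steps, each step one of d + 1 choices.
size≤ : ∀ {d r} (β : RBall d r) → size β ≤ suc d ^ r
size≤ {d} {r} β = injective⇒≤ {f = funToFin ∘ route} route-injective
  where
  route : Fin (size β) → Fin r → Fin (suc d)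
  route x = proj₁ (walk-complete d (graph β) (degOK β) r (centre β) x (isBall β x))
  walk-route : ∀ x → walk d (graph β) (centre β) r (route x) ≡ x
  walk-route x = proj₂ (walk-complete d (graph β) (degOK β) r (centre β) x (isBall β x))
  route-injective : Injective _≡_ _≡_ (funToFin ∘ route)
  route-injective {x} {y} eq = begin
    x                                                           ≡⟨ walk-route x ⟨
    walk d (graph β) (centre β) r (route x)                     ≡⟨ walk-cong d (graph β) (centre β) r route≗ ⟩
    walk d (graph β) (centre β) r (route y)                     ≡⟨ walk-route y ⟩
    y                                                           ∎
    where
    open ≡-Reasoning
    route≗ : ∀ i → route x i ≡ route y i
    route≗ i = trans (sym (finToFun-funToFin (route x) i)) (trans (cong (λ c → finToFun c i) eq) (finToFun-funToFin (route y) i))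

toBool : Fin 2 → Bool
toBool fz     = false
toBool (fs _) = true

fromBool : Bool → Fin 2
fromBool false = fz
fromBool true  = fs fz

toBool-fromBool : ∀ b → toBool (fromBool b) ≡ b
toBool-fromBool false = refl
toBool-fromBool true  = refl

adjacencyOf : ∀ m → Fin (2 ^ (m * m)) → Fin m → Fin m → Bool
adjacencyOf m c x y = toBool (finToFun c (combine x y))

codeOf : ∀ m → (Fin m → Fin m → Bool) → Fin (2 ^ (m * m))
codeOf m A = funToFin (fromBool ∘ uncurry A ∘ remQuot m)

adjacencyOf-codeOf : ∀ m A x y → adjacencyOf m (codeOf m A) x y ≡ A x y
adjacencyOf-codeOf m A x y = begin
  toBool (finToFun (codeOf m A) (combine x y))         ≡⟨ cong toBool (finToFun-funToFin _ (combine x y)) ⟩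
  toBool (fromBool (uncurry A (remQuot m (combine x y)))) ≡⟨ toBool-fromBool _ ⟩
  uncurry A (remQuot m (combine x y))                  ≡⟨ cong (uncurry A) (remQuot-combine x y) ⟩
  A x y                                                ∎
  where open ≡-Reasoning

symmetric? : ∀ {m} (A : Fin m → Fin m → Bool) → Dec (∀ x y → A x y ≡ A y x)
symmetric? A = all? λ x → all? λ y → A x y ≟B A y x

irreflexive? : ∀ {m} (A : Fin m → Fin m → Bool) → Dec (∀ x → A x x ≡ false)
irreflexive? A = all? λ x → A x x ≟B false

module _ (d r : ℕ) where

  candidateBall : ∀ m (G : Graph m) v → Dec (MaxDeg≤ G d) → Dec (IsBall G r v) → List (RBall d r)
  candidateBall m G v (yes dg) (yes bl) = ball m G v dg bl ∷ []
  candidateBall m G v _        _        = []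

  candidateGraph : ∀ m (A : Fin m → Fin m → Bool) v →
    Dec (∀ x y → A x y ≡ A y x) → Dec (∀ x → A x x ≡ false) → List (RBall d r)
  candidateGraph m A v (yes A-sym) (yes A-irrefl) =
    candidateBall m G v (all? λ w → degree G w ≤? d) (all? λ x → Within? G r v x)
    where G = record { adj = A ; sym = A-sym ; irrefl = A-irrefl }
  candidateGraph m A v _ _ = []

  candidates : ∀ m → Fin (2 ^ (m * m)) → Fin m → List (RBall d r)
  candidates m c v = candidateGraph m (adjacencyOf m c) v (symmetric? (adjacencyOf m c)) (irreflexive? (adjacencyOf m c))

  candidatesOfSize : ∀ m → Fin (2 ^ (m * m)) → List (RBall d r)
  candidatesOfSize m c = concatMap (candidates m c) (allFin m)

  ballsOfSize : ℕ → List (RBall d r)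
  ballsOfSize m = concatMap (candidatesOfSize m) (allFin (2 ^ (m * m)))

  allBalls : List (RBall d r)
  allBalls = concatMap ballsOfSize (upTo (suc (suc d ^ r)))

  module _ (β : RBall d r) where
    private
      m = size β
      B = adj (graph β)
      A = adjacencyOf m (codeOf m B)
      A≗B = adjacencyOf-codeOf m B

    identity-iso : ∀ (G : Graph m) → (∀ x y → adj G x y ≡ B x y) → ∀ dg bl → RootedIso β (ball m G (centre β) dg bl)
    identity-iso G G≗B dg bl = record
      { to = λ x → x ; from = λ x → x ; from∘to = λ _ → refl ; to∘from = λ _ → refl
      ; centre≡ = refl ; adj≡ = λ x y → sym (G≗B x y) }

    candidateBall-complete : ∀ (G : Graph m) → (∀ x y → adj G x y ≡ B x y) → ∀ dg? bl? →
      Σ[ γ ∈ RBall d r ] (γ ∈ candidateBall m G (centre β) dg? bl? × RootedIso β γ)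
    candidateBall-complete G G≗B (yes dg) (yes bl) = _ , here refl , identity-iso G G≗B dg bl
    candidateBall-complete G G≗B (no ¬dg) _ =
      ⊥-elim (¬dg λ w → subst (_≤ d) (count-cong λ i → sym (G≗B w i)) (degOK β w))
    candidateBall-complete G G≗B (yes _) (no ¬bl) =
      ⊥-elim (¬bl λ x → Within-cong (λ a b → sym (G≗B a b)) r (isBall β x))

    candidateGraph-complete : ∀ sym? irrefl? →
      Σ[ γ ∈ RBall d r ] (γ ∈ candidateGraph m A (centre β) sym? irrefl? × RootedIso β γ)
    candidateGraph-complete (yes _) (yes _) = candidateBall-complete _ A≗B _ _
    candidateGraph-complete (no ¬sym) _ =
      ⊥-elim (¬sym λ x y → trans (A≗B x y) (trans (Graph.sym (graph β) x y) (sym (A≗B y x))))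
    candidateGraph-complete (yes _) (no ¬irrefl) =
      ⊥-elim (¬irrefl λ x → trans (A≗B x x) (irrefl (graph β) x))

    allBalls-complete : Σ[ γ ∈ RBall d r ] (γ ∈ allBalls × RootedIso β γ)
    allBalls-complete =
      let (γ , γ∈ , β≅γ) = candidateGraph-complete (symmetric? A) (irreflexive? A) in
      γ , ∈-concatMap⁺ ballsOfSize (lose (∈-upTo⁺ (s≤s (size≤ β)))
            (∈-concatMap⁺ (candidatesOfSize m) (lose (∈-allFin (codeOf m B))
              (∈-concatMap⁺ (candidates m (codeOf m B)) (lose (∈-allFin (centre β)) γ∈))))) , β≅γ

-- A finite view of G: the listed vertices with their induced adjacency, and for the full ones also their
-- complete neighbourhood. The root only makes the view nonempty.
record Witness {n} (G : Graph n) : Set where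
  field
    vertices    : List (Fin n)
    root        : Fin n
    root∈       : root ∈ vertices
    isFull      : Fin n → Bool
    full-closed : ∀ x → isFull x ≡ true → x ∈ vertices × (∀ y → adj G x y ≡ true → y ∈ vertices)
open Witness public

-- What an embedding of the marked graph induced by W says about G′, read back along φ.
record Simulates {n n′} {G : Graph n} (W : Witness G) (G′ : Graph n′) (φ : Fin n → Fin n′) : Set where
  field
    injectiveOn   : ∀ {x y} → x ∈ vertices W → y ∈ vertices W → φ x ≡ φ y → x ≡ y
    adj-preserved : ∀ {x y} → x ∈ vertices W → y ∈ vertices W → adj G x y ≡ adj G′ (φ x) (φ y)
    full-image    : ∀ {x z} → isFull W x ≡ true → adj G′ (φ x) z ≡ true → Σ[ y ∈ Fin n ] (y ∈ vertices W × z ≡ φ y)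
open Simulates public

_⊑_ : ∀ {n} {G : Graph n} → Witness G → Witness G → Set
V ⊑ W = (vertices V ⊆ vertices W) × (∀ x → isFull V x ≡ true → isFull W x ≡ true)

Simulates-⊑ : ∀ {n n′} {G : Graph n} {V W : Witness G} {G′ : Graph n′} {φ} → V ⊑ W → Simulates W G′ φ → Simulates V G′ φ
Simulates-⊑ {G = G} {V} {W} {G′} {φ} (V⊆W , V-full⇒W-full) S = record
  { injectiveOn   = λ x∈ y∈ → injectiveOn S (V⊆W x∈) (V⊆W y∈)
  ; adj-preserved = λ x∈ y∈ → adj-preserved S (V⊆W x∈) (V⊆W y∈)
  ; full-image    = full-image-V }
  where
  full-image-V : ∀ {x z} → isFull V x ≡ true → adj G′ (φ x) z ≡ true → Σ[ y ∈ _ ] (y ∈ vertices V × z ≡ φ y)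
  full-image-V {x} {z} x-full φx~z with full-image S (V-full⇒W-full x x-full) φx~z
  ... | (y , y∈W , z≡φy) = y , proj₂ (full-closed V x x-full) y x~y , z≡φy
    where
    x∈V = proj₁ (full-closed V x x-full)
    x~y : adj G x y ≡ true
    x~y = trans (adj-preserved S (V⊆W x∈V) y∈W) (trans (cong (adj G′ (φ x)) (sym z≡φy)) φx~z)

Simulates⇒length≤ : ∀ {n n′} {G : Graph n} {W : Witness G} {G′ : Graph n′} {φ} → Simulates W G′ φ →
  ∀ {xs ys} → Unique xs → xs ⊆ vertices W → (∀ {x} → x ∈ xs → φ x ∈ ys) → length xs ≤ length ys
Simulates⇒length≤ {W = W} {φ = φ} S {xs} {ys} xs-u xs⊆W φxs⊆ys =
  subst (_≤ _) (length-map φ xs) (unique-⊆⇒length≤ φxs-u φxs⊆ys′)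
  where
  φxs-u : Unique (map φ xs)
  φxs-u = unique-map⁺-injectiveOn φ (_∈ vertices W) (All.tabulate xs⊆W) (injectiveOn S) xs-u
  φxs⊆ys′ : map φ xs ⊆ ys
  φxs⊆ys′ p with ∈-map⁻ φ p
  ... | (x , x∈ , refl) = φxs⊆ys x∈

module _ {n n′} {G : Graph n} {W : Witness G} {G′ : Graph n′} {φ} (S : Simulates W G′ φ) where

  Within-preserved : ∀ t {w x} → (∀ z → Within G t w z → z ∈ vertices W) → Within G t w x → Within G′ t (φ w) (φ x)
  Within-preserved zero    ball⊆W w≡x = cong φ w≡x
  Within-preserved (suc t) ball⊆W (inj₁ w≡x) = inj₁ (cong φ w≡x)
  Within-preserved (suc t) {w} ball⊆W (inj₂ (y , w~y , y⇝x)) =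
    inj₂ (φ y , trans (sym (adj-preserved S (ball⊆W w (inj₁ refl)) (ball⊆W y (inj₂ (y , w~y , Within-refl G t y))))) w~y
         , Within-preserved t (λ z y⇝z → ball⊆W z (inj₂ (y , w~y , y⇝z))) y⇝x)

  -- Walking in G′ out of the image of a ball whose interior is full never leaves the image of that ball.
  module _ {r v} (ball⊆W : ∀ x → Within G r v x → x ∈ vertices W)
                 (interior-full : ∀ x → Within< G r v x → isFull W x ≡ true) where

    interior-edge-reflected : ∀ {w z} → Within< G r v w → adj G′ (φ w) z ≡ true →
      Σ[ y ∈ Fin n ] (adj G w y ≡ true × z ≡ φ y)
    interior-edge-reflected {w} {z} v⇝w φw~z with full-image S (interior-full w v⇝w) φw~z
    ... | (y , y∈ , z≡φy) = y , trans (adj-preserved S w∈ y∈) (trans (cong (adj G′ (φ w)) (sym z≡φy)) φw~z) , z≡φy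
      where
      w∈ : w ∈ vertices W
      w∈ = ball⊆W w (Within<⇒Within G r v⇝w)

    Within-reflected : ∀ t s {w z} → s + t ≡ r → Within G s v w → Within G′ t (φ w) z →
      Σ[ y ∈ Fin n ] (Within G r v y × z ≡ φ y)
    Within-reflected zero s {w} s+0≡r v⇝w φw≡z =
      w , Within-mono G (≤-reflexive (trans (sym (+-identityʳ s)) s+0≡r)) v⇝w , sym φw≡z
    Within-reflected (suc t) s {w} s+t≡r v⇝w (inj₁ φw≡z) =
      w , Within-mono G (subst (s ≤_) s+t≡r (m≤m+n s (suc t))) v⇝w , sym φw≡z
    Within-reflected (suc t) s {w} {z} s+t≡r v⇝w (inj₂ (z₁ , φw~z₁ , z₁⇝z)) =
      let (y , w~y , z₁≡φy) = interior-edge-reflected w-interior φw~z₁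
      in Within-reflected t (suc s) s+1+t≡r (Within-snoc G s v⇝w w~y) (subst (λ a → Within G′ t a z) z₁≡φy z₁⇝z)
      where
      s+1+t≡r : suc s + t ≡ r
      s+1+t≡r = trans (sym (+-suc s t)) s+t≡r
      w-interior : Within< G r v w
      w-interior = subst (λ a → Within< G a v w) s+1+t≡r (Within-mono G (m≤m+n s t) v⇝w)

    IsNbhdIso-preserved : ∀ {d} {β : RBall d r} {f} → IsNbhdIso r G v β f → IsNbhdIso r G′ (φ v) β (φ ∘ f)
    IsNbhdIso-preserved {β = β} {f} (f-inj , f-in , f-onto , f-centre , f-adj) =
        (λ eq → f-inj (injectiveOn S (f∈ _) (f∈ _) eq))
      , (λ y → Within-preserved r ball⊆W (f-in y))
      , (λ z v⇝z → let (x , v⇝x , z≡φx) = Within-reflected r 0 refl refl v⇝z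
                       (y , fy≡x) = f-onto x v⇝x
                   in y , trans (cong φ fy≡x) (sym z≡φx))
      , cong φ f-centre
      , (λ y z → trans (f-adj y z) (adj-preserved S (f∈ y) (f∈ z)))
      where
      f∈ : ∀ y → f y ∈ vertices W
      f∈ y = ball⊆W (f y) (f-in y)

_∈?_ : ∀ {n} (x : Fin n) xs → Dec (x ∈ xs)
x ∈? xs = anyL? (x ≟F_) xs

markOf : Bool → Mark
markOf true  = full
markOf false = semifull

module _ {m n} {F : Graph m} {G : Graph n} {f : Fin m → Fin n} (f-inj : Injective _≡_ _≡_ f) (i : Fin m) where

  adj≡-from-N1 : (∀ j → adj G (f i) (f j) ≡ true → InImageN1 F f i (f j)) →
    (∀ j → InImageN1 F f i (f j) → InN1 G (f i) (f j)) → ∀ j → adj F i j ≡ adj G (f i) (f j)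
  adj≡-from-N1 G⇒F F⇒G j = ⇔→≡ (mk⇔ F⇒G′ G⇒F′)
    where
    G⇒F′ : adj G (f i) (f j) ≡ true → adj F i j ≡ true
    G⇒F′ fi~fj with G⇒F j fi~fj
    ... | (j′ , fj≡fj′ , inj₁ j′≡i) =
      ⊥-elim (not-¬ (subst (λ z → adj G (f i) z ≡ true) (trans fj≡fj′ (cong f j′≡i)) fi~fj) (irrefl G (f i)))
    ... | (j′ , fj≡fj′ , inj₂ i~j′) = subst (λ z → adj F i z ≡ true) (sym (f-inj fj≡fj′)) i~j′
    F⇒G′ : adj F i j ≡ true → adj G (f i) (f j) ≡ true
    F⇒G′ i~j with F⇒G j (j , refl , inj₂ i~j)
    ... | inj₁ fj≡fi = ⊥-elim (not-¬ (subst (λ z → adj F i z ≡ true) (f-inj fj≡fi) i~j) (irrefl F i))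
    ... | inj₂ fi~fj = fi~fj

  EmbedCond⇒adj≡ : ∀ b → EmbedCond (markOf b) F G f i → ∀ j → adj F i j ≡ adj G (f i) (f j)
  EmbedCond⇒adj≡ true  cond = adj≡-from-N1 (λ j fi~fj → Equivalence.to (cond (f j)) (inj₂ fi~fj))
                                           (λ j p → Equivalence.from (cond (f j)) p)
  EmbedCond⇒adj≡ false cond = adj≡-from-N1 (λ j fi~fj → Equivalence.to (cond (f j)) (inj₂ fi~fj , j , refl))
                                           (λ j p → proj₁ (Equivalence.from (cond (f j)) p))

module InducedMarkedGraph {n} {G : Graph n} (W : Witness G) where

  members : List (Fin n)
  members = filter (_∈? vertices W) (allFin n)

  order : ℕ
  order = length members

  members-unique : Unique members
  members-unique = filter⁺ (_∈? vertices W) (allFin⁺ n)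

  members⊆ : members ⊆ vertices W
  members⊆ p = proj₂ (∈-filter⁻ (_∈? vertices W) {xs = allFin n} p)

  ⊆members : vertices W ⊆ members
  ⊆members {x} p = ∈-filter⁺ (_∈? vertices W) (∈-allFin x) p

  vertexAt : Fin order → Fin n
  vertexAt = lookup members

  vertexAt-injective : Injective _≡_ _≡_ vertexAt
  vertexAt-injective = unique⇒lookup-injective members-unique

  positionOf : ∀ {x} → x ∈ vertices W → Fin order
  positionOf p = index (⊆members p)

  vertexAt-positionOf : ∀ {x} (p : x ∈ vertices W) → x ≡ vertexAt (positionOf p)
  vertexAt-positionOf p = lookup-index (⊆members p)

  base-graph : Graph order
  base-graph = record
    { adj = λ i j → adj G (vertexAt i) (vertexAt j)
    ; sym = λ i j → Graph.sym G (vertexAt i) (vertexAt j)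
    ; irrefl = λ i → irrefl G (vertexAt i) }

  markedGraph : MarkedGraph order
  markedGraph = record { base = base-graph ; mark = λ i → markOf (isFull W (vertexAt i)) }

  markedGraph-embeds : Embeds markedGraph G
  markedGraph-embeds = vertexAt , vertexAt-injective , (λ i → embedCond i _ refl)
    where
    InImageN1⇒InN1 : ∀ i x → InImageN1 base-graph vertexAt i x → InN1 G (vertexAt i) x
    InImageN1⇒InN1 i x (j , x≡ , inj₁ j≡i) = inj₁ (trans x≡ (cong vertexAt j≡i))
    InImageN1⇒InN1 i x (j , x≡ , inj₂ i~j) = inj₂ (subst (λ z → adj G (vertexAt i) z ≡ true) (sym x≡) i~j)

    embedCond : ∀ i b → isFull W (vertexAt i) ≡ b → EmbedCond (markOf b) base-graph G vertexAt i
    embedCond i true i-full x = mk⇔ N1⇒image (InImageN1⇒InN1 i x)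
      where
      N1⇒image : InN1 G (vertexAt i) x → InImageN1 base-graph vertexAt i x
      N1⇒image (inj₁ x≡) = i , x≡ , inj₁ refl
      N1⇒image (inj₂ i~x) =
        let x∈ = ⊆members (proj₂ (full-closed W (vertexAt i) i-full) x i~x)
            x≡ = lookup-index x∈
        in index x∈ , x≡ , inj₂ (subst (λ z → adj G (vertexAt i) z ≡ true) x≡ i~x)
    embedCond i false _ x = mk⇔ N1∩image⇒image (λ q → InImageN1⇒InN1 i x q , proj₁ q , proj₁ (proj₂ q))
      where
      N1∩image⇒image : InN1 G (vertexAt i) x × InImage vertexAt x → InImageN1 base-graph vertexAt i x
      N1∩image⇒image (inj₁ x≡ , j , x≡′) = j , x≡′ , inj₁ (vertexAt-injective (trans (sym x≡′) x≡))
      N1∩image⇒image (inj₂ i~x , j , x≡′) = j , x≡′ , inj₂ (subst (λ z → adj G (vertexAt i) z ≡ true) x≡′ i~x)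

  module _ {n′} {G′ : Graph n′} (emb : Embeds markedGraph G′) where
    private
      g = proj₁ emb
      g-inj = proj₁ (proj₂ emb)
      g-cond = proj₂ (proj₂ emb)

    -- Off the witness φ is arbitrary; it sends everything to the image of the root.
    extend : ∀ x → Dec (x ∈ members) → Fin n′
    extend x (yes p) = g (index p)
    extend x (no _)  = g (positionOf (root∈ W))

    φ : Fin n → Fin n′
    φ x = extend x (x ∈? members)

    φ-vertexAt : ∀ j → φ (vertexAt j) ≡ g j
    φ-vertexAt j with vertexAt j ∈? members
    ... | yes p = cong g (sym (vertexAt-injective (lookup-index p)))
    ... | no ∉  = ⊥-elim (∉ (∈-lookup {xs = members} j))

    φ-positionOf : ∀ {x} (p : x ∈ vertices W) → φ x ≡ g (positionOf p)
    φ-positionOf p = trans (cong φ (vertexAt-positionOf p)) (φ-vertexAt (positionOf p))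

    embedding⇒simulation : Simulates W G′ φ
    embedding⇒simulation = record { injectiveOn = injectiveOn′ ; adj-preserved = adj-preserved′ ; full-image = full-image′ }
      where
      open ≡-Reasoning
      injectiveOn′ : ∀ {x y} → x ∈ vertices W → y ∈ vertices W → φ x ≡ φ y → x ≡ y
      injectiveOn′ p q φx≡φy = begin
        _                       ≡⟨ vertexAt-positionOf p ⟩
        vertexAt (positionOf p) ≡⟨ cong vertexAt (g-inj (trans (sym (φ-positionOf p)) (trans φx≡φy (φ-positionOf q)))) ⟩
        vertexAt (positionOf q) ≡⟨ vertexAt-positionOf q ⟨
        _                       ∎
      adj-preserved′ : ∀ {x y} → x ∈ vertices W → y ∈ vertices W → adj G x y ≡ adj G′ (φ x) (φ y)
      adj-preserved′ p q = begin
        adj G _ _                                         ≡⟨ cong₂ (adj G) (vertexAt-positionOf p) (vertexAt-positionOf q) ⟩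
        adj G (vertexAt (positionOf p)) (vertexAt (positionOf q))
          ≡⟨ EmbedCond⇒adj≡ g-inj (positionOf p) _ (g-cond (positionOf p)) (positionOf q) ⟩
        adj G′ (g (positionOf p)) (g (positionOf q))      ≡⟨ cong₂ (adj G′) (φ-positionOf p) (φ-positionOf q) ⟨
        adj G′ (φ _) (φ _)                                ∎
      full-cond : ∀ i b → b ≡ true → EmbedCond (markOf b) base-graph G′ g i → EmbedCond full base-graph G′ g i
      full-cond i true refl cond = cond
      full-image′ : ∀ {x z} → isFull W x ≡ true → adj G′ (φ x) z ≡ true → Σ[ y ∈ Fin n ] (y ∈ vertices W × z ≡ φ y)
      full-image′ {x} {z} x-full φx~z with Equivalence.to (full-cond (positionOf x∈) _ p-full (g-cond (positionOf x∈)) z)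
                                              (inj₂ (subst (λ u → adj G′ u z ≡ true) (φ-positionOf x∈) φx~z))
        where
        x∈ = proj₁ (full-closed W x x-full)
        p-full = trans (cong (isFull W) (sym (vertexAt-positionOf x∈))) x-full
      ... | (j , z≡gj , _) = vertexAt j , members⊆ (∈-lookup {xs = members} j) , trans z≡gj (sym (φ-vertexAt j))

Refutes : ∀ {n} {G : Graph n} → Witness G → GraphProperty → Set
Refutes W Q = ∀ {n′} (G′ : Graph n′) φ → Simulates W G′ φ → ¬ Q G′

Refutation : ∀ {n} → Graph n → ℕ → GraphProperty → Set
Refutation G b Q = Σ[ W ∈ Witness G ] (length (vertices W) ≤ b × Refutes W Q)

Refutation-weaken : ∀ {n} {G : Graph n} {b b′} {Q Q′ : GraphProperty} → b ≤ b′ → (∀ {n} {H : Graph n} → Q′ H → Q H) →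
  Refutation G b Q → Refutation G b′ Q′
Refutation-weaken b≤b′ Q′⇒Q (W , len≤ , refutes) = W , ≤-trans len≤ b≤b′ , λ G′ φ S → refutes G′ φ S ∘ Q′⇒Q

module _ {n} {G : Graph n} (d : ℕ) {v} (big : ¬ degree G v ≤ d) where
  private
    some-neighbours = take (suc d) (neighbours G v)

    length-some : length some-neighbours ≡ suc d
    length-some = length-take≡ (neighbours G v) (subst (suc d ≤_) (sym (length-neighbours G v)) (≰⇒> big))

    W : Witness G
    W = record { vertices = v ∷ some-neighbours ; root = v ; root∈ = here refl ; isFull = λ _ → false ; full-closed = λ _ () }

  -- No vertex needs to be full: the d + 1 edges at v survive any simulation.
  degree-refutation : Refutation G (suc (suc d)) (λ G′ → MaxDeg≤ G′ d)
  degree-refutation = W , ≤-reflexive (cong suc length-some) , refutes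
    where
    refutes : Refutes W (λ G′ → MaxDeg≤ G′ d)
    refutes G′ φ S deg≤ = 1+n≰n (begin-strict
      d                                  <⟨ ≤-reflexive (sym length-some) ⟩
      length some-neighbours             ≤⟨ Simulates⇒length≤ S (take⁺ (suc d) (neighbours-unique G v)) there φ-neighbour ⟩
      length (neighbours G′ (φ v))       ≡⟨ length-neighbours G′ (φ v) ⟩
      degree G′ (φ v)                    ≤⟨ deg≤ (φ v) ⟩
      d                                  ∎)
      where
      open ≤-Reasoning
      φ-neighbour : ∀ {w} → w ∈ some-neighbours → φ w ∈ neighbours G′ (φ v)
      φ-neighbour w∈ = ∈-neighbours⁺ G′ (trans (sym (adj-preserved S (here refl) (there w∈)))
                                               (∈-neighbours⁻ G (take-⊆ (suc d) (neighbours G v) w∈)))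

module _ {n} {G : Graph n} {d r} (β : RBall d r) {u} (many : u < length (centres r G β)) where
  private
    chosen : List (Fin n)
    chosen = take (suc u) (centres r G β)

    length-chosen : length chosen ≡ suc u
    length-chosen = length-take≡ (centres r G β) many

    isoAt : Fin n → Fin (size β) → Fin n
    isoAt v with NbhdIso? r G v β
    ... | yes (f , _) = f
    ... | no _        = λ _ → v

    isoAt-isNbhdIso : ∀ {v} → v ∈ chosen → IsNbhdIso r G v β (isoAt v)
    isoAt-isNbhdIso {v} v∈ with NbhdIso? r G v β
    ... | yes (_ , iso) = iso
    ... | no ¬iso       = ⊥-elim (¬iso (∈-centres⁻ r G β (take-⊆ (suc u) (centres r G β) v∈)))

    ballAt : Fin n → List (Fin n)
    ballAt v = map (isoAt v) (allFin (size β))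

    balls : List (Fin n)
    balls = concatMap ballAt chosen

    ball⊆ : ∀ {v x} → v ∈ chosen → Within G r v x → x ∈ chosen ++ balls
    ball⊆ {v} v∈ v⇝x with proj₁ (proj₂ (proj₂ (isoAt-isNbhdIso v∈))) _ v⇝x
    ... | (y , refl) = ∈-++⁺ʳ chosen (∈-concatMap⁺ ballAt (lose v∈ (∈-map⁺ (isoAt v) (∈-allFin y))))

    isFull-chosen : Fin n → Bool
    isFull-chosen x = does (anyL? (λ v → Within<? G r v x) chosen)

    closed : ∀ x → isFull-chosen x ≡ true → x ∈ chosen ++ balls × (∀ y → adj G x y ≡ true → y ∈ chosen ++ balls)
    closed x x-full with find (does⇒witness (anyL? (λ v → Within<? G r v x) chosen) x-full)
    ... | (v , v∈ , v⇝x) = ball⊆ v∈ (Within<⇒Within G r v⇝x) , λ y x~y → ball⊆ v∈ (Within<-step G r v⇝x x~y)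

    first∈ : Σ[ x ∈ Fin n ] x ∈ chosen
    first∈ = ∈-of-nonempty chosen (subst (0 <_) (sym length-chosen) (s≤s z≤n))

    W : Witness G
    W = record { vertices = chosen ++ balls ; root = proj₁ first∈ ; root∈ = ∈-++⁺ˡ (proj₂ first∈)
               ; isFull = isFull-chosen ; full-closed = closed }

    length-W : length (vertices W) ≡ suc u * suc (size β)
    length-W = begin
      length (chosen ++ balls)            ≡⟨ length-++ chosen ⟩
      length chosen + length balls        ≡⟨ cong₂ _+_ length-chosen (length-concatMap-const isoAt chosen) ⟩
      suc u + length chosen * size β      ≡⟨ cong (λ l → suc u + l * size β) length-chosen ⟩
      suc u + suc u * size β              ≡⟨ *-suc (suc u) (size β) ⟨
      suc u * suc (size β)                ∎
      where open ≡-Reasoning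

    -- Each chosen centre keeps its r-type in G′, since its whole r-ball lies in W with full interior.
    refutes : Refutes W (λ G′ → length (centres r G′ β) ≤ u)
    refutes G′ φ S count≤u = 1+n≰n (begin
      suc u                         ≡⟨ length-chosen ⟨
      length chosen                 ≤⟨ Simulates⇒length≤ S (take⁺ (suc u) (centres-unique r G β)) ∈-++⁺ˡ φ-centre ⟩
      length (centres r G′ β)       ≤⟨ count≤u ⟩
      u                             ∎)
      where
      open ≤-Reasoning
      φ-centre : ∀ {v} → v ∈ chosen → φ v ∈ centres r G′ β
      φ-centre {v} v∈ =
        ∈-centres⁺ r G′ β (φ ∘ isoAt v ,
          IsNbhdIso-preserved S (λ x → ball⊆ v∈) interior-full {β = β} {isoAt v} (isoAt-isNbhdIso v∈))
        where
        interior-full : ∀ x → Within< G r v x → isFull-chosen x ≡ true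
        interior-full x v⇝x = dec-true (anyL? (λ v → Within<? G r v x) chosen) (lose v∈ v⇝x)

  type-refutation : Refutation G (suc u * suc (size β)) (λ G′ → length (centres r G′ β) ≤ u)
  type-refutation = W , ≤-reflexive length-W , refutes

upperOr0 : Interval → ℕ
upperOr0 [ k , just l ]  = l
upperOr0 [ k , nothing ] = 0

_∈I?_ : ∀ c I → Dec (c ∈I I)
c ∈I? [ k , just l ]  = (k ≤? c) ×-dec (c ≤? l)
c ∈I? [ k , nothing ] = k ≤? c

zero-lower-violation : ∀ {c} I → lower I ≡ 0 → ¬ (c ∈I I) → Σ[ u ∈ ℕ ] (I ≡ [ 0 , just u ] × u < c)
zero-lower-violation {c} [ .0 , just l ] refl c∉ with c ≤? l
... | yes c≤l = ⊥-elim (c∉ (z≤n , c≤l))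
... | no  c≰l = l , refl , ≰⇒> c≰l
zero-lower-violation [ .0 , nothing ] refl c∉ = ⊥-elim (c∉ z≤n)

module _ {d r} (P : Profile d r) where

  maxUpper : ℕ
  maxUpper = max 0 (map (upperOr0 ∘ ρ P) (allBalls d r))

  witnessBound : ℕ
  witnessBound = suc (suc d) + suc maxUpper * suc (suc d ^ r)

  obeys-from-allBalls : ∀ {n} (G : Graph n) → MaxDeg≤ G d →
    All (λ β → length (centres r G β) ∈I ρ P β) (allBalls d r) → Obeys G P
  obeys-from-allBalls G deg≤ allBalls-ok = deg≤ , λ β c count≡c →
    let (γ , γ∈ , β≅γ) = allBalls-complete d r β in
    subst₂ _∈I_ (HistCount-functional r G γ (histCount-centres r G γ) (HistCount-resp-≅ β≅γ count≡c))
                (sym (invariant P β γ β≅γ)) (All.lookup allBalls-ok γ∈)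

  violation-refutation : IsZeroProfile P → ∀ {n} (G : Graph n) {β} → β ∈ allBalls d r →
    ¬ (length (centres r G β) ∈I ρ P β) → Refutation G witnessBound (λ G′ → Obeys G′ P)
  violation-refutation zero-profile G {β} β∈ count∉ =
    Refutation-weaken (≤-trans (*-mono-≤ (s≤s u≤max) (s≤s (size≤ β))) (m≤n+m _ (suc (suc d))))
                      count≤u (type-refutation β many)
    where
    violation : Σ[ u ∈ ℕ ] (ρ P β ≡ [ 0 , just u ] × u < length (centres r G β))
    violation = zero-lower-violation (ρ P β) (zero-profile β) count∉
    u : ℕ
    u = proj₁ violation
    ρβ≡ : ρ P β ≡ [ 0 , just u ]
    ρβ≡ = proj₁ (proj₂ violation)
    many : u < length (centres r G β)
    many = proj₂ (proj₂ violation)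
    u≤max : u ≤ maxUpper
    u≤max = subst (λ I → upperOr0 I ≤ maxUpper) ρβ≡ (All.lookup (xs≤max 0 _) (∈-map⁺ (upperOr0 ∘ ρ P) β∈))
    count≤u : ∀ {n} {G′ : Graph n} → Obeys G′ P → length (centres r G′ β) ≤ u
    count≤u {G′ = G′} (_ , obeys) =
      proj₂ (subst (length (centres r G′ β) ∈I_) ρβ≡ (obeys β _ (histCount-centres r G′ β)))

  obeys-or-refuted : IsZeroProfile P → ∀ {n} (G : Graph n) → Obeys G P ⊎ Refutation G witnessBound (λ G′ → Obeys G′ P)
  obeys-or-refuted zero-profile {n} G with all? (λ v → degree G v ≤? d)
  ... | no ¬deg≤ =
    let (v , big) = ¬∀⟶∃¬ n _ (λ v → degree G v ≤? d) ¬deg≤ in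
    inj₂ (Refutation-weaken (m≤m+n (suc (suc d)) _) proj₁ (degree-refutation d big))
  ... | yes deg≤ with All.all? (λ β → length (centres r G β) ∈I? ρ P β) (allBalls d r)
  ...   | yes allBalls-ok = inj₁ (obeys-from-allBalls G deg≤ allBalls-ok)
  ...   | no ¬allBalls-ok =
    let (β , β∈ , count∉) = find (¬All⇒Any¬ (λ β → length (centres r G β) ∈I? ρ P β) (allBalls d r) ¬allBalls-ok)
    in inj₂ (violation-refutation zero-profile G β∈ count∉)

module _ {n} {G : Graph n} {k} (W : Fin (suc k) → Witness G) where

  ⋃-witness : Witness G
  ⋃-witness = record
    { vertices = concatMap (vertices ∘ W) (allFin (suc k)) ; root = root (W fz) ; root∈ = ∈-⋃ fz (root∈ (W fz))
    ; isFull = λ x → does (any? λ i → isFull (W i) x ≟B true) ; full-closed = closed }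
    where
    ∈-⋃ : ∀ i {x} → x ∈ vertices (W i) → x ∈ concatMap (vertices ∘ W) (allFin (suc k))
    ∈-⋃ i x∈ = ∈-concatMap⁺ (vertices ∘ W) (lose (∈-allFin i) x∈)
    closed : ∀ x → does (any? λ i → isFull (W i) x ≟B true) ≡ true →
      x ∈ _ × (∀ y → adj G x y ≡ true → y ∈ concatMap (vertices ∘ W) (allFin (suc k)))
    closed x x-full =
      let (i , full-i) = does⇒witness (any? λ i → isFull (W i) x ≟B true) x-full
          (x∈ , nbrs∈) = full-closed (W i) x full-i
      in ∈-⋃ i x∈ , λ y x~y → ∈-⋃ i (nbrs∈ y x~y)

  ⊑-⋃ : ∀ i → W i ⊑ ⋃-witness
  ⊑-⋃ i = (λ x∈ → ∈-concatMap⁺ (vertices ∘ W) (lose (∈-allFin i) x∈))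
        , λ x full-i → dec-true (any? λ i → isFull (W i) x ≟B true) (i , full-i)

emptyMarkedGraph : MarkedGraph 0
emptyMarkedGraph = record { base = record { adj = λ () ; sym = λ () ; irrefl = λ () } ; mark = λ () }

emptyMarkedGraph-embeds : ∀ {n} (G : Graph n) → Embeds emptyMarkedGraph G
emptyMarkedGraph-embeds G = (λ ()) , (λ { {()} }) , (λ ())

refutations⇒markedGraph : ∀ k {n} (G : Graph n) (bound : Fin k → ℕ) (Q : Fin k → GraphProperty) →
  (∀ i → Refutation G (bound i) (Q i)) →
  Σ[ m ∈ ℕ ] Σ[ H ∈ MarkedGraph m ]
    (m ≤ sum (map bound (allFin k)) × (∀ {n′} (G′ : Graph n′) → Embeds H G′ → ∀ i → ¬ Q i G′) × Embeds H G)
refutations⇒markedGraph zero G bound Q refutations =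
  0 , emptyMarkedGraph , z≤n , (λ G′ _ ()) , emptyMarkedGraph-embeds G
refutations⇒markedGraph (suc k) G bound Q refutations =
  order , markedGraph , order≤ , refuted , markedGraph-embeds
  where
  W : Fin (suc k) → Witness G
  W = proj₁ ∘ refutations
  open InducedMarkedGraph (⋃-witness W)
  order≤ : order ≤ sum (map bound (allFin (suc k)))
  order≤ = ≤-trans (unique-⊆⇒length≤ members-unique members⊆)
                   (length-concatMap≤sum (vertices ∘ W) bound (allFin (suc k)) (proj₁ ∘ proj₂ ∘ refutations))
  refuted : ∀ {n′} (G′ : Graph n′) → Embeds markedGraph G′ → ∀ i → ¬ Q i G′
  refuted G′ emb i = proj₂ (proj₂ (refutations i)) G′ (φ emb) (Simulates-⊑ (⊑-⋃ W i) (embedding⇒simulation emb))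

theorem7p11 : (d k : ℕ) (rs : Fin k → ℕ) (ρs : (i : Fin k) → Profile d (rs i))
    → (∀ i → IsZeroProfile (ρs i))
    → IsGSFLocal (UnionOfProfiles d k rs ρs)
theorem7p11 d k rs ρs zero-profiles = forbidden , s , (λ _ _ _ → proj₁) , λ n G → mk⇔ (obeys⇒free G) (free⇒obeys G)
  where
  s : ℕ
  s = sum (map (witnessBound ∘ ρs) (allFin k))

  forbidden : ℕ → MarkedSet
  forbidden n (m , H) = m ≤ s × (∀ (G′ : Graph n) → Embeds H G′ → ¬ UnionOfProfiles d k rs ρs G′)

  obeys⇒free : ∀ {n} (G : Graph n) → UnionOfProfiles d k rs ρs G → Free (forbidden n) G
  obeys⇒free G obeys m H (_ , refutes) emb = refutes G emb obeys

  free⇒obeys : ∀ {n} (G : Graph n) → Free (forbidden n) G → UnionOfProfiles d k rs ρs G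
  free⇒obeys G free with ∀⊎⇒∃⊎∀ k (λ i → obeys-or-refuted (ρs i) (zero-profiles i) G)
  ... | inj₁ obeys = obeys
  ... | inj₂ refutations =
    let (m , H , m≤s , refuted , emb) =
          refutations⇒markedGraph k G (witnessBound ∘ ρs) (λ i G′ → Obeys G′ (ρs i)) refutations
    in ⊥-elim (free m H (m≤s , λ G′ emb′ (i , obeys) → refuted G′ emb′ i obeys) emb)
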